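{- For integers $j,k,n\ge 0$, let $$a_n(j,k)=\binom{n}{j}^2\binom{n}{k}^2\binom{n+j}{n}\binom{n+k}{n}\binom{j+k}{n}.$$ Then for all integers $n\ge 1$ and $j,k\ge 0$: (a) $v_2\big(a_n(j,k)\big)=1$ if and only if $\{j,k\}=\{0,n\}$ and $n$ is a power of $2$; (b) $v_2\big(a_n(j,k)\big)\ge 2$ otherwise.
   Context: $v_2$ denotes the $2$-adic valuation, with the convention $v_2(0)=+\infty$. Binomial coefficients $\binom{a}{b}$ with $b>a\ge 0$ are $0$. Powers of $2$ are the integers $2^m$, $m\ge 0$. -}

module Defs where

open import Data.Nat using (ℕ; _+_; _*_; _^_)
open import Data.Nat.Combinatorics using (_C_)
open import Data.Nat.Divisibility using (_∣_)
open import Data.Product using (_×_; ∃)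
open import Data.Sum using (_⊎_)
open import Relation.Nullary using (¬_)
open import Relation.Binary.PropositionalEquality using (_≡_)

a : ℕ → ℕ → ℕ → ℕ
a n j k = (n C j) ^ 2 * (n C k) ^ 2 * ((n + j) C n) * ((n + k) C n) * ((j + k) C n)

-- v₂(x) = m  (finite valuation; never holds for x = 0, where v₂ = +∞)
V2≡ : ℕ → ℕ → Set
V2≡ x m = (2 ^ m ∣ x) × ¬ (2 ^ (m + 1) ∣ x)

-- v₂(x) ≥ m  (holds for x = 0, consistent with v₂(0) = +∞)
V2≥ : ℕ → ℕ → Set
V2≥ x m = 2 ^ m ∣ x

IsPowerOf2 : ℕ → Set
IsPowerOf2 n = ∃ λ m → n ≡ 2 ^ m

PairIs0n : ℕ → ℕ → ℕ → Set
PairIs0n n j k = (j ≡ 0 × k ≡ n) ⊎ (j ≡ n × k ≡ 0)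

-- Proof strategy.  Write c(n) = C(2n,n) for the central binomial coefficient.
--
--  * Central binomials.  c(m+1) = 2·D(m) with D(m) = C(2m+1,m).  Lucas'
--    theorem modulo 2, proved for the four parity classes of the arguments
--    through the parity homomorphism ℕ → Parity, gives D(2t+1) ≡ D(t) and
--    D(2u+2) ≡ 0 (mod 2); hence D(m) is odd iff m+1 is a power of 2, i.e.
--    v₂(c(n)) = 1 when n is a power of 2 and v₂(c(n)) ≥ 2 otherwise.
--  * Interior points.  By the "subset of a subset" identity, for n = j + c
--      C(n,j) C(n+j,n) = C(n+j,c) C(2j,j),
--    and C(2j,j) = c(j) is even for j ≥ 1; for j > n the left side is 0.
--    So j,k ≥ 1 yields two even factors of a_n(j,k), and 4 ∣ a_n(j,k).
--  * Edge points.  a_n(0,k) = C(n,k)² C(n+k,n) C(k,n) vanishes unless k = n,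
--    where it equals c(n); k = 0 follows by the symmetry a_n(j,k) = a_n(k,j).
-- Hence either {j,k} = {0,n} and a_n(j,k) = c(n), or 4 ∣ a_n(j,k); combined
-- with the classification of v₂(c(n)) this is the theorem.
module Submission where

open import Defs
open import Data.Nat using (ℕ; _≥_)
open import Data.Product using (_×_)
open import Function.Bundles using (_⇔_)
open import Relation.Nullary using (¬_; yes; no)
open import Data.Nat
open import Data.Nat.Properties
open import Data.Nat.DivMod using (m/n*n≡m)
open import Data.Nat.Divisibility
open import Data.Nat.Combinatorics
open import Data.Nat.Induction using (<-rec)
open import Data.Nat.Tactic.RingSolver using (solve-∀)
open import Data.Parity.Base as ℙ using (0ℙ; 1ℙ)
open import Data.Parity.Properties using (+-homo-+; *-homo-*; p+p≡0ℙ)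
import Data.Parity.Properties as ℙ
open import Data.Product as Product using (∃; _,_; proj₂)
open import Data.Sum as Sum using (_⊎_; inj₁; inj₂)
open import Data.Empty using (⊥-elim)
open import Function.Base using (_∘_)
open import Function.Bundles using (mk⇔)
open import Relation.Binary.PropositionalEquality
open import Relation.Binary.Definitions using (tri<; tri≈; tri>)
open ≡-Reasoning

parity≡0ℙ⇒2∣ : ∀ x → parity x ≡ 0ℙ → 2 ∣ x
parity≡0ℙ⇒2∣ zero          _    = 2 ∣0
parity≡0ℙ⇒2∣ (suc (suc x)) even = ∣m∣n⇒∣m+n (∣-refl {2}) (parity≡0ℙ⇒2∣ x even)

2∣⇒parity≡0ℙ : ∀ x → 2 ∣ x → parity x ≡ 0ℙ
2∣⇒parity≡0ℙ .(q * 2) (divides-refl q) = trans (*-homo-* q 2) (ℙ.*-zeroʳ (parity q))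

v2-double-odd : ∀ x → parity x ≡ 1ℙ → V2≡ (2 * x) 1
v2-double-odd x odd = m∣m*n x , λ 4∣2x →
  0ℙ≢1ℙ (trans (sym (2∣⇒parity≡0ℙ x (*-cancelˡ-∣ 2 4∣2x))) odd)
  where
  0ℙ≢1ℙ : 0ℙ ≢ 1ℙ
  0ℙ≢1ℙ ()

4∣double-even : ∀ x → parity x ≡ 0ℙ → 4 ∣ 2 * x
4∣double-even x even = *-pres-∣ (∣-refl {2}) (parity≡0ℙ⇒2∣ x even)

4∣⇒¬V2≡1 : ∀ {x} → 4 ∣ x → ¬ V2≡ x 1
4∣⇒¬V2≡1 4∣x v = proj₂ v 4∣x

-- Lucas' theorem modulo 2.

-- Doubling by recursion, so that double (suc m) reduces to suc (suc (double m));
-- this makes the induction in Lucas' theorem structural.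
double : ℕ → ℕ
double zero    = zero
double (suc m) = suc (suc (double m))

double≡+ : ∀ m → double m ≡ m + m
double≡+ zero    = refl
double≡+ (suc m) = cong suc (trans (cong suc (double≡+ m)) (sym (+-suc m m)))

double≡2* : ∀ m → double m ≡ 2 * m
double≡2* m = trans (double≡+ m) (cong (m +_) (sym (+-identityʳ m)))

pascal-parity : ∀ n k → parity (suc n C suc k) ≡ parity (n C k) ℙ.+ parity (n C suc k)
pascal-parity n k = trans (cong parity (sym (nCk+nC[k+1]≡[n+1]C[k+1] n k))) (+-homo-+ (n C k) (n C suc k))

mutual
  lucas-even-even : ∀ a b → parity (double a C double b) ≡ parity (a C b)
  lucas-even-even zero    zero    = refl
  lucas-even-even zero    (suc b) = refl
  lucas-even-even (suc a) zero    = refl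
  lucas-even-even (suc a) (suc b) = begin
    parity (suc (suc da) C suc (suc db))
      ≡⟨ pascal-parity (suc da) (suc db) ⟩
    parity (suc da C suc db) ℙ.+ parity (suc da C suc (suc db))
      ≡⟨ cong₂ ℙ._+_ (pascal-parity da db) (pascal-parity da (suc db)) ⟩
    (parity (da C db) ℙ.+ parity (da C suc db))
      ℙ.+ (parity (da C suc db) ℙ.+ parity (da C double (suc b)))
      ≡⟨ cong₂ ℙ._+_ (cong₂ ℙ._+_ (lucas-even-even a b) (lucas-even-odd a b))
                     (cong₂ ℙ._+_ (lucas-even-odd a b) (lucas-even-even a (suc b))) ⟩
    (parity (a C b) ℙ.+ 0ℙ) ℙ.+ parity (a C suc b)
      ≡⟨ cong (ℙ._+ parity (a C suc b)) (ℙ.+-identityʳ (parity (a C b))) ⟩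
    parity (a C b) ℙ.+ parity (a C suc b)
      ≡⟨ pascal-parity a b ⟨
    parity (suc a C suc b) ∎
    where da = double a ; db = double b

  lucas-even-odd : ∀ a b → parity (double a C suc (double b)) ≡ 0ℙ
  lucas-even-odd zero    b       = refl
  lucas-even-odd (suc a) zero    = begin
    parity (suc (suc (double a)) C 1)
      ≡⟨ pascal-parity (suc (double a)) 0 ⟩
    1ℙ ℙ.+ parity (suc (double a) C 1)
      ≡⟨ cong (1ℙ ℙ.+_) (pascal-parity (double a) 0) ⟩
    1ℙ ℙ.+ (1ℙ ℙ.+ parity (double a C 1))
      ≡⟨ cong (λ p → 1ℙ ℙ.+ (1ℙ ℙ.+ p)) (lucas-even-odd a zero) ⟩
    0ℙ ∎
  lucas-even-odd (suc a) (suc b) = begin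
    parity (suc (suc da) C suc (suc (suc db)))
      ≡⟨ pascal-parity (suc da) (suc (suc db)) ⟩
    parity (suc da C suc (suc db)) ℙ.+ parity (suc da C suc (suc (suc db)))
      ≡⟨ cong₂ ℙ._+_ (pascal-parity da (suc db)) (pascal-parity da (suc (suc db))) ⟩
    (parity (da C suc db) ℙ.+ x) ℙ.+ (x ℙ.+ parity (da C suc (double (suc b))))
      ≡⟨ cong₂ (λ p q → (p ℙ.+ x) ℙ.+ (x ℙ.+ q)) (lucas-even-odd a b) (lucas-even-odd a (suc b)) ⟩
    x ℙ.+ (x ℙ.+ 0ℙ)
      ≡⟨ cong (x ℙ.+_) (ℙ.+-identityʳ x) ⟩
    x ℙ.+ x
      ≡⟨ p+p≡0ℙ x ⟩
    0ℙ ∎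
    where da = double a ; db = double b ; x = parity (da C double (suc b))

lucas-odd-even : ∀ a b → parity (suc (double a) C double b) ≡ parity (a C b)
lucas-odd-even a zero    = refl
lucas-odd-even a (suc b) = begin
  parity (suc (double a) C suc (suc (double b)))
    ≡⟨ pascal-parity (double a) (suc (double b)) ⟩
  parity (double a C suc (double b)) ℙ.+ parity (double a C double (suc b))
    ≡⟨ cong₂ ℙ._+_ (lucas-even-odd a b) (lucas-even-even a (suc b)) ⟩
  parity (a C suc b) ∎

lucas-odd-odd : ∀ a b → parity (suc (double a) C suc (double b)) ≡ parity (a C b)
lucas-odd-odd a b = begin
  parity (suc (double a) C suc (double b))
    ≡⟨ pascal-parity (double a) (double b) ⟩
  parity (double a C double b) ℙ.+ parity (double a C suc (double b))
    ≡⟨ cong₂ ℙ._+_ (lucas-even-even a b) (lucas-even-odd a b) ⟩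
  parity (a C b) ℙ.+ 0ℙ
    ≡⟨ ℙ.+-identityʳ (parity (a C b)) ⟩
  parity (a C b) ∎

-- Central binomial coefficients.

C-sym : ∀ m k → (m + k) C m ≡ (m + k) C k
C-sym m k = trans (nCk≡nC[n∸k] (m≤m+n m k)) (cong ((m + k) C_) (m+n∸m≡n m k))

D : ℕ → ℕ
D m = suc (double m) C m

central≡2D : ∀ m → (suc m + suc m) C suc m ≡ 2 * D m
central≡2D m = begin
  (suc m + suc m) C suc m
    ≡⟨ cong (_C suc m) (double≡+ (suc m)) ⟨
  suc (suc (double m)) C suc m
    ≡⟨ nCk+nC[k+1]≡[n+1]C[k+1] (suc (double m)) m ⟨
  D m + suc (double m) C suc m
    ≡⟨ cong (D m +_) odd-sym ⟩
  D m + D m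
    ≡⟨ cong (D m +_) (+-identityʳ (D m)) ⟨
  2 * D m ∎
  where
  odd-sym : suc (double m) C suc m ≡ D m
  odd-sym = subst (λ x → x C suc m ≡ x C m) (cong suc (sym (double≡+ m))) (C-sym (suc m) m)

central-even : ∀ j → 1 ≤ j → 2 ∣ (j + j) C j
central-even (suc m) _ = subst (2 ∣_) (sym (central≡2D m)) (m∣m*n (D m))

D-odd-step : ∀ t → parity (D (suc (double t))) ≡ parity (D t)
D-odd-step t = lucas-odd-odd (suc (double t)) t

D-even-step : ∀ u → parity (D (double (suc u))) ≡ 0ℙ
D-even-step u = begin
  parity (D (double (suc u)))
    ≡⟨ lucas-odd-even (double (suc u)) (suc u) ⟩
  parity (double (suc u) C suc u)
    ≡⟨ cong (λ x → parity (x C suc u)) (double≡+ (suc u)) ⟩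
  parity ((suc u + suc u) C suc u)
    ≡⟨ cong parity (central≡2D u) ⟩
  parity (2 * D u)
    ≡⟨ *-homo-* 2 (D u) ⟩
  0ℙ ∎

halve : ∀ m → (∃ λ t → m ≡ double t) ⊎ (∃ λ t → m ≡ suc (double t))
halve zero = inj₁ (0 , refl)
halve (suc m) with halve m
... | inj₁ (t , m≡2t)   = inj₂ (t , cong suc m≡2t)
... | inj₂ (t , m≡2t+1) = inj₁ (suc t , cong suc m≡2t+1)

t<2t+1 : ∀ t → t < suc (double t)
t<2t+1 t = s≤s (subst (t ≤_) (sym (double≡+ t)) (m≤m+n t t))

D-odd⇒pow : ∀ m → parity (D m) ≡ 1ℙ → IsPowerOf2 (suc m)
D-odd⇒pow = <-rec (λ m → parity (D m) ≡ 1ℙ → IsPowerOf2 (suc m)) step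
  where
  step : ∀ m → (∀ {t} → t < m → parity (D t) ≡ 1ℙ → IsPowerOf2 (suc t)) →
         parity (D m) ≡ 1ℙ → IsPowerOf2 (suc m)
  step m rec odd with halve m
  ... | inj₁ (zero , refl) = 0 , refl
  ... | inj₁ (suc u , refl) with () ← trans (sym odd) (D-even-step u)
  ... | inj₂ (t , refl) with rec (t<2t+1 t) (trans (sym (D-odd-step t)) odd)
  ...   | e , t+1≡2^e = suc e , trans (double≡2* (suc t)) (cong (2 *_) t+1≡2^e)

pow⇒D-odd : ∀ e m → suc m ≡ 2 ^ e → parity (D m) ≡ 1ℙ
pow⇒D-odd zero    zero    _ = refl
pow⇒D-odd (suc e) m m+1≡2^e+1 with 2 ^ e | m^n>0 2 e | pow⇒D-odd e
... | suc s | _ | ih = begin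
  parity (D m)                ≡⟨ cong (parity ∘ D) m≡2s+1 ⟩
  parity (D (suc (double s))) ≡⟨ D-odd-step s ⟩
  parity (D s)                ≡⟨ ih s refl ⟩
  1ℙ ∎
  where
  m≡2s+1 : m ≡ suc (double s)
  m≡2s+1 = suc-injective (trans m+1≡2^e+1 (sym (double≡2* (suc s))))

central-classification : ∀ n → n ≥ 1 →
  (IsPowerOf2 n × V2≡ ((n + n) C n) 1) ⊎ (¬ IsPowerOf2 n × 4 ∣ (n + n) C n)
central-classification (suc m) _ rewrite central≡2D m with parity (D m) in eq
... | 1ℙ = inj₁ (D-odd⇒pow m eq , v2-double-odd (D m) eq)
... | 0ℙ = inj₂ (not-pow , 4∣double-even (D m) eq)
  where
  not-pow : ¬ IsPowerOf2 (suc m)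
  not-pow (e , m+1≡2^e) with () ← trans (sym eq) (pow⇒D-odd e m m+1≡2^e)

-- Interior points: 4 ∣ a_n(j,k) when j,k ≥ 1.

C-fact-left : ∀ m k → ((m + k) C m) * (m ! * k !) ≡ (m + k) !
C-fact-left m k with k![n∸k]!∣n! (m≤m+n m k) | nCk≡n!/k![n-k]! (m≤m+n m k)
... | m!k!∣ | C≡ rewrite m+n∸m≡n m k = trans (cong (_* (m ! * k !)) C≡) (m/n*n≡m m!k!∣)
  where instance _ = m !* k !≢0

C-fact-right : ∀ m k → ((m + k) C k) * (m ! * k !) ≡ (m + k) !
C-fact-right m k = trans (cong (_* (m ! * k !)) (sym (C-sym m k))) (C-fact-left m k)

-- "Subset of a subset": choosing a (a+b)-set inside an (a+b+c)-set and then
-- a b-set inside it is the same as choosing the b-set first and then the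
-- complementary a-set among the remaining a+c elements.
subset-of-subset : ∀ a b c →
  ((a + b + c) C (a + b)) * ((a + b) C b) ≡ ((a + b + c) C b) * ((a + c) C a)
subset-of-subset a b c = *-cancelʳ-≡ _ _ (a ! * b ! * c !) (trans lhs (sym rhs))
  where
  instance _ = m*n≢0 (a ! * b !) (c !) {{a !* b !≢0}} {{c !≢0}}
  regroup : ∀ x y p q r → x * y * (p * q * r) ≡ x * (y * (p * q) * r)
  regroup = solve-∀
  regroup′ : ∀ x y p q r → x * y * (p * q * r) ≡ x * (y * (p * r) * q)
  regroup′ = solve-∀
  reassoc : a + b + c ≡ a + c + b
  reassoc = trans (+-assoc a b c) (trans (cong (a +_) (+-comm b c)) (sym (+-assoc a c b)))
  lhs : ((a + b + c) C (a + b)) * ((a + b) C b) * (a ! * b ! * c !) ≡ (a + b + c) !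
  lhs = begin
    ((a + b + c) C (a + b)) * ((a + b) C b) * (a ! * b ! * c !)
      ≡⟨ regroup ((a + b + c) C (a + b)) ((a + b) C b) (a !) (b !) (c !) ⟩
    ((a + b + c) C (a + b)) * (((a + b) C b) * (a ! * b !) * c !)
      ≡⟨ cong (λ z → ((a + b + c) C (a + b)) * (z * c !)) (C-fact-right a b) ⟩
    ((a + b + c) C (a + b)) * ((a + b) ! * c !)
      ≡⟨ C-fact-left (a + b) c ⟩
    (a + b + c) ! ∎
  rhs : ((a + b + c) C b) * ((a + c) C a) * (a ! * b ! * c !) ≡ (a + b + c) !
  rhs = begin
    ((a + b + c) C b) * ((a + c) C a) * (a ! * b ! * c !)
      ≡⟨ regroup′ ((a + b + c) C b) ((a + c) C a) (a !) (b !) (c !) ⟩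
    ((a + b + c) C b) * (((a + c) C a) * (a ! * c !) * b !)
      ≡⟨ cong (λ z → ((a + b + c) C b) * (z * b !)) (C-fact-left a c) ⟩
    ((a + b + c) C b) * ((a + c) ! * b !)
      ≡⟨ cong (λ s → (s C b) * ((a + c) ! * b !)) reassoc ⟩
    ((a + c + b) C b) * ((a + c) ! * b !)
      ≡⟨ C-fact-right (a + c) b ⟩
    (a + c + b) !
      ≡⟨ cong _! reassoc ⟨
    (a + b + c) ! ∎

-- For j ≥ 1, C(n,j) C(n+j,n) = C(n+j,c) C(2j,j) (n = j + c) is even.
even-factor : ∀ n j → 1 ≤ j → 2 ∣ (n C j) * ((n + j) C n)
even-factor n j 1≤j with j ≤? n
... | no j≰n rewrite k>n⇒nCk≡0 (≰⇒> j≰n) = 2 ∣0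
... | yes j≤n with c , refl ← m≤n⇒∃[o]m+o≡n j≤n =
  subst (2 ∣_) (sym factorisation) (∣n⇒∣m*n ((j + c + j) C c) (central-even j 1≤j))
  where
  factorisation : ((j + c) C j) * ((j + c + j) C (j + c)) ≡ ((j + c + j) C c) * ((j + j) C j)
  factorisation = begin
    ((j + c) C j) * ((j + c + j) C (j + c)) ≡⟨ *-comm ((j + c) C j) _ ⟩
    ((j + c + j) C (j + c)) * ((j + c) C j) ≡⟨ cong (((j + c + j) C (j + c)) *_) (C-sym j c) ⟩
    ((j + c + j) C (j + c)) * ((j + c) C c) ≡⟨ subset-of-subset j c j ⟩
    ((j + c + j) C c) * ((j + j) C j)       ∎

interior-divisible : ∀ n j k → 1 ≤ j → 1 ≤ k → 4 ∣ a n j k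
interior-divisible n j k 1≤j 1≤k =
  subst (4 ∣_) (sym (regroup (n C j) (n C k) ((n + j) C n) ((n + k) C n) ((j + k) C n)))
    (∣m⇒∣m*n _ (*-pres-∣ (even-factor n j 1≤j) (even-factor n k 1≤k)))
  where
  -- x ^ 2 unfolds to x * (x * 1), the form the ring solver reads.
  regroup : ∀ x y p q r → x * (x * 1) * (y * (y * 1)) * p * q * r ≡ (x * p) * (y * q) * (x * y * r)
  regroup = solve-∀

-- Edge points: a_n(0,k) vanishes unless k = n, and a_n(0,n) = C(2n,n).

-- a_n(j,k) is symmetric in j and k; this reduces the edge k = 0 to j = 0.
a-symmetric : ∀ n j k → a n j k ≡ a n k j
a-symmetric n j k = trans (swap (n C j) (n C k) ((n + j) C n) ((n + k) C n) ((j + k) C n))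
                          (cong a′ (+-comm j k))
  where
  a′ : ℕ → ℕ
  a′ s = (n C k) ^ 2 * (n C j) ^ 2 * ((n + k) C n) * ((n + j) C n) * (s C n)
  swap : ∀ x y p q r → x * (x * 1) * (y * (y * 1)) * p * q * r ≡ y * (y * 1) * (x * (x * 1)) * q * p * r
  swap = solve-∀

-- For k < n the factor C(k,n) vanishes, for k > n the factor C(n,k) does.
a-edge-vanish : ∀ n k → k ≢ n → a n 0 k ≡ 0
a-edge-vanish n k k≢n with <-cmp k n
... | tri< k<n _ _ rewrite k>n⇒nCk≡0 k<n =
  *-zeroʳ ((n C 0) ^ 2 * (n C k) ^ 2 * ((n + 0) C n) * ((n + k) C n))
... | tri> _ _ k>n rewrite k>n⇒nCk≡0 k>n = refl
... | tri≈ _ k≡n _ = ⊥-elim (k≢n k≡n)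

-- At (0,n) every factor except C(2n,n) equals 1.
a-edge-diag : ∀ n → a n 0 n ≡ (n + n) C n
a-edge-diag n rewrite +-identityʳ n | nCn≡1 n = trans (*-identityʳ _) (*-identityˡ _)

Classified : ℕ → ℕ → ℕ → Set
Classified n j k = (PairIs0n n j k × a n j k ≡ (n + n) C n) ⊎ (¬ PairIs0n n j k × 4 ∣ a n j k)

pair-swap : ∀ {n j k} → PairIs0n n j k → PairIs0n n k j
pair-swap = Sum.swap ∘ Sum.map Product.swap Product.swap

classified-swap : ∀ {n j k} → Classified n j k → Classified n k j
classified-swap {n} {j} {k} (inj₁ (pair , a≡)) = inj₁ (pair-swap pair , trans (a-symmetric n k j) a≡)
classified-swap {n} {j} {k} (inj₂ (¬pair , 4∣a)) =
  inj₂ (¬pair ∘ pair-swap , subst (4 ∣_) (a-symmetric n j k) 4∣a)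

classify : ∀ n j k → n ≥ 1 → Classified n j k
classify n zero k n≥1 with k ≟ n
... | yes refl = inj₁ (inj₁ (refl , refl) , a-edge-diag k)
... | no k≢n  = inj₂ (not-pair , subst (4 ∣_) (sym (a-edge-vanish n k k≢n)) (4 ∣0))
  where
  not-pair : ¬ PairIs0n n 0 k
  not-pair (inj₁ (_ , k≡n)) = k≢n k≡n
  not-pair (inj₂ (0≡n , _)) = <⇒≢ n≥1 0≡n
classify n (suc j) zero    n≥1 = classified-swap (classify n zero (suc j) n≥1)
classify n (suc j) (suc k) _   =
  inj₂ ((λ { (inj₁ (() , _)) ; (inj₂ (_ , ())) }) , interior-divisible n (suc j) (suc k) (s≤s z≤n) (s≤s z≤n))

mainTheorem1 : ∀ (n j k : ℕ) → n ≥ 1 →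
    (V2≡ (a n j k) 1 ⇔ (PairIs0n n j k × IsPowerOf2 n))
    × (¬ (PairIs0n n j k × IsPowerOf2 n) → V2≥ (a n j k) 2)
mainTheorem1 n j k n≥1 with classify n j k n≥1
... | inj₂ (¬pair , 4∣a) =
  mk⇔ (⊥-elim ∘ 4∣⇒¬V2≡1 4∣a) (λ (pair , _) → ⊥-elim (¬pair pair)) , λ _ → 4∣a
... | inj₁ (pair , a≡central) rewrite a≡central with central-classification n n≥1
...   | inj₁ (pow , v2≡1) = mk⇔ (λ _ → pair , pow) (λ _ → v2≡1) , λ ¬both → ⊥-elim (¬both (pair , pow))
...   | inj₂ (¬pow , 4∣c) =
  mk⇔ (⊥-elim ∘ 4∣⇒¬V2≡1 4∣c) (λ (_ , pow) → ⊥-elim (¬pow pow)) , λ _ → 4∣c
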